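{- Let $k\in\mathbb N$ be a constant. Let $G=(V,E)$ be a connected graph and let $M_1,M_2$ be split-modules of $G$ such that $M_1\cup M_2=V$ and $\max(\mathrm{rw}(G[M_1]),\mathrm{rw}(G[M_2]))\le k$. Then $\mathrm{rw}(G)\le k+1$.
   Context: All graphs are finite, simple and undirected; $\mathrm{rw}$ is rank-width. For $A\subseteq V(G)$, $N(A)$ is the set of vertices outside $A$ with a neighbour in $A$. A split of a connected graph $G=(V,E)$ is a bipartition $\{A,B\}$ of $V$ such that every vertex of $N(B)$ has the same neighbourhood in $N(A)$. A split-module of $G$ is a set $A\subseteq V$ such that for some connected component $G'=(V',E')$ of $G$, $\{A,V'\setminus A\}$ is a split of $G'$; $V$ and $\emptyset$ are also split-modules. -}

module Defs where

open import Data.Nat using (ℕ; zero; suc)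
open import Data.Fin using (Fin; zero; suc)
open import Data.Bool using (Bool; true; false; _∧_; _xor_)
open import Data.List using (List; []; _∷_; _++_)
open import Data.List.Membership.Propositional using (_∈_)
open import Data.List.Relation.Unary.Unique.Propositional using (Unique)
open import Data.Product using (Σ; _×_; ∃)
open import Data.Sum using (_⊎_)
open import Relation.Nullary using (¬_)
open import Relation.Binary.PropositionalEquality using (_≡_)

record Graph : Set where
  field
    n      : ℕ
    adj    : Fin n → Fin n → Bool
    sym    : ∀ u v → adj u v ≡ adj v u
    irrefl : ∀ v → adj v v ≡ false
open Graph public

Sub : ℕ → Set
Sub n = Fin n → Bool

xorSum : ∀ k → (Fin k → Bool) → Bool
xorSum zero    f = false
xorSum (suc k) f = f zero xor xorSum k (λ i → f (suc i))

-- RankLe G k X Y : the GF(2) matrix A[X,Y] (rows X, columns Y, entries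
-- the adjacency of G) has rank ≤ k, i.e. its row space is spanned by k
-- vectors b₀,…,b_{k-1}: every row is a GF(2)-linear combination of them
-- (on the columns in Y).
RankLe : (G : Graph) → ℕ → (X Y : Fin (n G) → Set) → Set
RankLe G k X Y =
  Σ (Fin k → Fin (n G) → Bool) λ b →
    ∀ x → X x → Σ (Fin k → Bool) λ c →
      ∀ y → Y y → adj G x y ≡ xorSum k (λ i → c i ∧ b i y)

CutRankLe : (G : Graph) → Sub (n G) → ℕ → (Fin (n G) → Set) → Set
CutRankLe G S k X = RankLe G k X (λ y → (S y ≡ true) × ¬ X y)

-- Rank-decompositions, presented as rooted full binary trees (a subcubic
-- tree with a subdivided edge as root); the edges of the tree correspond
-- to the non-root nodes, whose leaf sets are the cut sides.

data BTree (m : ℕ) : Set where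
  leaf : Fin m → BTree m
  node : BTree m → BTree m → BTree m

leaves : ∀ {m} → BTree m → List (Fin m)
leaves (leaf v)   = v ∷ []
leaves (node l r) = leaves l ++ leaves r

InT : ∀ {m} → BTree m → Fin m → Set
InT t v = v ∈ leaves t

WidthLe : (G : Graph) → Sub (n G) → ℕ → BTree (n G) → Set
WidthLe G S k (leaf v)   = CutRankLe G S k (InT (leaf v))
WidthLe G S k (node l r) =
  WidthLe G S k l × WidthLe G S k r × CutRankLe G S k (InT (node l r))

IsDecompOf : (G : Graph) → Sub (n G) → BTree (n G) → Set
IsDecompOf G S t =
  Unique (leaves t) × (∀ v → (S v ≡ true → InT t v) × (InT t v → S v ≡ true))

-- rw(G[S]) ≤ k   (the graph with no vertices has rank-width 0)
RwLe : (G : Graph) → Sub (n G) → ℕ → Set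
RwLe G S k =
  (∀ v → S v ≡ false) ⊎ Σ (BTree (n G)) λ t → IsDecompOf G S t × WidthLe G S k t

data Reach (G : Graph) : Fin (n G) → Fin (n G) → Set where
  here : ∀ {u} → Reach G u u
  step : ∀ {u w v} → adj G u w ≡ true → Reach G w v → Reach G u v

Connected : Graph → Set
Connected G = ∀ u v → Reach G u v

IsComponent : (G : Graph) → Sub (n G) → Set
IsComponent G C = Σ (Fin (n G)) λ c →
  ∀ v → (C v ≡ true → Reach G c v) × (Reach G c v → C v ≡ true)

NbIn : (G : Graph) → Sub (n G) → (Fin (n G) → Set) → Fin (n G) → Set
NbIn G C P u = (C u ≡ true) × ¬ P u × Σ (Fin (n G)) λ v → P v × (adj G u v ≡ true)

-- {A ∩ C, C ∖ A} is a split of the component G[C]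
IsSplit : (G : Graph) → (C A : Sub (n G)) → Set
IsSplit G C A =
  (∃ λ v → InA v) × (∃ λ v → InB v) ×
  (∀ x y z → NbIn G C InB x → NbIn G C InB y → NbIn G C InA z →
     adj G x z ≡ adj G y z)
  where
    InA : Fin (n G) → Set
    InA v = (C v ≡ true) × (A v ≡ true)
    InB : Fin (n G) → Set
    InB v = (C v ≡ true) × (A v ≡ false)

SplitModule : (G : Graph) → Sub (n G) → Set
SplitModule G M =
  (∀ v → M v ≡ true) ⊎ (∀ v → M v ≡ false) ⊎
  Σ (Sub (n G)) λ C → IsComponent G C × (∀ v → M v ≡ true → C v ≡ true) × IsSplit G C M

-- Write A = M₁ and B = V ∖ A. Since {A, B} is a split of G, a ∈ A and b ∈ B are
-- adjacent iff a has a neighbour in B and b has a neighbour in A, so the A × B block of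
-- the adjacency matrix has rank at most one. Join a rank-decomposition of G[A] and one of
-- G[M₂] pruned to B ⊆ M₂ below a common root. A cut X ⊆ A of the first tree sees, in G,
-- the columns (A ∖ X) ∪ B, and X ∩ B of the second sees (M₂ ∖ X) ∪ (A ∖ M₂); in both
-- cases the extra columns add a rank-one block, so every cut-rank grows by at most one.
-- Only M₁ has to be a split-module.
module Submission where

open import Defs hiding (sym)
open import Level using (0ℓ)
open import Function using (_∘_)
open import Data.Nat using (ℕ; zero; suc)
open import Data.Fin using (Fin; zero; suc)
open import Data.Fin.Properties using (any?)
open import Data.Bool using (Bool; true; false; _∧_; _∨_; _xor_; not; if_then_else_)
open import Data.Bool.Properties using (∧-comm; ∧-zeroʳ; xor-identityʳ; ¬-not; not-¬) renaming (_≟_ to _≟ᵇ_)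
open import Data.Maybe using (Maybe; just; nothing; maybe)
open import Data.List using (List; []; _++_; filter)
open import Data.List.Properties using (++-identityʳ; filter-++)
open import Data.List.Membership.Propositional using (_∈_)
open import Data.List.Membership.Propositional.Properties using (∈-filter⁺; ∈-filter⁻; ∈-++⁺ˡ; ∈-++⁺ʳ)
open import Data.List.Relation.Unary.Any using (here)
open import Data.List.Relation.Unary.Any.Properties using (¬Any[])
open import Data.List.Relation.Unary.Unique.Propositional using (Unique; [])
import Data.List.Relation.Unary.Unique.Propositional.Properties as Unique
open import Data.Vec.Functional using () renaming (_∷_ to _◂_)
open import Data.Product using (Σ; ∃; _×_; _,_; proj₁; proj₂; map₂)
open import Data.Sum using (_⊎_; inj₁; inj₂; [_,_]′)
open import Data.Unit using (⊤; tt)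
open import Data.Empty using (⊥; ⊥-elim)
open import Relation.Nullary using (yes; no; does)
open import Relation.Nullary.Decidable using (_×-dec_; dec-true)
open import Relation.Unary using (Pred; Decidable; _⊆_; _≐_; _∩_; ∁)
open import Relation.Binary.PropositionalEquality using (_≡_; refl; sym; trans; cong; cong₂; subst; module ≡-Reasoning)

everything : ∀ {m} → Sub m
everything _ = true

xorSum-false : ∀ k (f : Fin k → Bool) → (∀ i → f i ≡ false) → xorSum k f ≡ false
xorSum-false zero    f f≡false = refl
xorSum-false (suc k) f f≡false rewrite f≡false zero = xorSum-false k (f ∘ suc) (f≡false ∘ suc)

leavesᴹ : ∀ {m} → Maybe (BTree m) → List (Fin m)
leavesᴹ = maybe leaves []

join : ∀ {m} → Maybe (BTree m) → Maybe (BTree m) → Maybe (BTree m)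
join nothing  t        = t
join (just l) nothing  = just l
join (just l) (just r) = just (node l r)

leaves-join : ∀ {m} (s t : Maybe (BTree m)) → leavesᴹ (join s t) ≡ leavesᴹ s ++ leavesᴹ t
leaves-join nothing  t        = refl
leaves-join (just l) nothing  = sym (++-identityʳ (leaves l))
leaves-join (just l) (just r) = refl

module _ {m} {P : Pred (Fin m) 0ℓ} (P? : Decidable P) where

  restrict : BTree m → Maybe (BTree m)
  restrict (leaf v)   = if does (P? v) then just (leaf v) else nothing
  restrict (node l r) = join (restrict l) (restrict r)

  leaves-restrict : ∀ t → leavesᴹ (restrict t) ≡ filter P? (leaves t)
  leaves-restrict (leaf v) with does (P? v)
  ... | true  = refl
  ... | false = refl
  leaves-restrict (node l r) = begin
    leavesᴹ (join (restrict l) (restrict r))           ≡⟨ leaves-join (restrict l) (restrict r) ⟩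
    leavesᴹ (restrict l) ++ leavesᴹ (restrict r)       ≡⟨ cong₂ _++_ (leaves-restrict l) (leaves-restrict r) ⟩
    filter P? (leaves l) ++ filter P? (leaves r)       ≡⟨ filter-++ P? (leaves l) (leaves r) ⟨
    filter P? (leaves l ++ leaves r)                   ∎
    where open ≡-Reasoning

  ∈-restrict : ∀ t → InT t ∩ P ≐ (_∈ leavesᴹ (restrict t))
  ∈-restrict t =
    (λ (v∈t , Pv) → subst (_ ∈_) (sym (leaves-restrict t)) (∈-filter⁺ P? v∈t Pv)) ,
    (λ v∈t′ → ∈-filter⁻ P? (subst (_ ∈_) (leaves-restrict t) v∈t′))

WidthLeᴹ : (G : Graph) → Sub (n G) → ℕ → Maybe (BTree (n G)) → Set
WidthLeᴹ G S k = maybe (WidthLe G S k) ⊤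

-- The trees of the two sides of the root edge of a rank-decomposition of G of width ≤ k;
-- the leaves are exactly P, and `nothing` stands for the empty tree.
record PartialRankDecomposition (G : Graph) (k : ℕ) (P : Pred (Fin (n G)) 0ℓ) : Set where
  field
    tree    : Maybe (BTree (n G))
    unique  : Unique (leavesᴹ tree)
    leaves≐ : (_∈ leavesᴹ tree) ≐ P
    width   : WidthLeᴹ G everything k tree

record RankOneCut (G : Graph) (A : Sub (n G)) : Set where
  field
    row col : Fin (n G) → Bool
    factor  : ∀ {a b} → A a ≡ true → A b ≡ false → adj G a b ≡ row a ∧ col b

module _ {G : Graph} where

  private
    V : Set
    V = Fin (n G)

  RankLe-⊆ : ∀ {k} {X X′ Y Y′ : Pred V 0ℓ} → X′ ⊆ X → Y′ ⊆ Y → RankLe G k X Y → RankLe G k X′ Y′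
  RankLe-⊆ X′⊆X Y′⊆Y (b , span) =
    b , λ x x∈X′ → map₂ (λ entry y y∈Y′ → entry y (Y′⊆Y y∈Y′)) (span x (X′⊆X x∈X′))

  -- The new basis vector is g on the columns in D; the old ones are cut down to ∁ D.
  RankLe-extend : ∀ {k} {X Y D : Pred V 0ℓ} → Decidable D → (f g : V → Bool) →
    (∀ {x y} → X x → Y y → D y → adj G x y ≡ f x ∧ g y) →
    RankLe G k X (Y ∩ ∁ D) → RankLe G (suc k) X Y
  RankLe-extend {k} {X} {Y} {D} D? f g rank-one (b , span) = b′ , λ x x∈X → row x∈X (span x x∈X)
    where
      b′ : Fin (suc k) → V → Bool
      b′ = (λ y → does (D? y) ∧ g y) ◂ λ i y → not (does (D? y)) ∧ b i y

      row : ∀ {x} → X x →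
        (Σ (Fin k → Bool) λ c → ∀ y → (Y ∩ ∁ D) y → adj G x y ≡ xorSum k (λ i → c i ∧ b i y)) →
        Σ (Fin (suc k) → Bool) λ c′ → ∀ y → Y y → adj G x y ≡ xorSum (suc k) (λ i → c′ i ∧ b′ i y)
      row {x} x∈X (c , entry) = f x ◂ c , entry′
        where
          entry′ : ∀ y → Y y → adj G x y ≡ xorSum (suc k) (λ i → (f x ◂ c) i ∧ b′ i y)
          entry′ y y∈Y with D? y
          ... | yes y∈D = trans (rank-one x∈X y∈Y y∈D)
                            (sym (trans (cong ((f x ∧ g y) xor_) (xorSum-false k _ (∧-zeroʳ ∘ c)))
                                        (xor-identityʳ (f x ∧ g y))))
          ... | no  y∉D = trans (entry y (y∈Y , y∉D)) (cong (_xor _) (sym (∧-zeroʳ (f x))))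

  CutRankLe-cong : ∀ {S k} {X Y : Pred V 0ℓ} → X ≐ Y → CutRankLe G S k X → CutRankLe G S k Y
  CutRankLe-cong (X⊆Y , Y⊆X) = RankLe-⊆ Y⊆X (map₂ λ y∉Y y∈X → y∉Y (X⊆Y y∈X))

  CutRankLe-everything : ∀ {S k} {X : Pred V 0ℓ} → (∀ v → X v) → CutRankLe G S k X
  CutRankLe-everything X≡V = (λ _ _ → false) , λ _ _ → (λ _ → false) , λ y (_ , y∉X) → ⊥-elim (y∉X (X≡V y))

  WidthLe-map : ∀ {S S′ k k′} t →
    (∀ {X} → X ⊆ InT t → CutRankLe G S k X → CutRankLe G S′ k′ X) →
    WidthLe G S k t → WidthLe G S′ k′ t
  WidthLe-map (leaf v)   cut w = cut (λ v∈X → v∈X) w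
  WidthLe-map (node l r) cut (wl , wr , c) =
    WidthLe-map l (λ X⊆l → cut (λ x∈X → ∈-++⁺ˡ (X⊆l x∈X))) wl ,
    WidthLe-map r (λ X⊆r → cut (λ x∈X → ∈-++⁺ʳ (leaves l) (X⊆r x∈X))) wr ,
    cut (λ x∈X → x∈X) c

  WidthLe-join : ∀ {S k} (s t : Maybe (BTree (n G))) →
    WidthLeᴹ G S k s → WidthLeᴹ G S k t → CutRankLe G S k (_∈ leavesᴹ (join s t)) →
    WidthLeᴹ G S k (join s t)
  WidthLe-join nothing  t        _  wt _    = wt
  WidthLe-join (just l) nothing  wl _  _    = wl
  WidthLe-join (just l) (just r) wl wr root = wl , wr , root

  WidthLe-restrict : ∀ {S S′ k k′} {P : Pred V 0ℓ} (P? : Decidable P) →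
    (∀ {X} → CutRankLe G S k X → CutRankLe G S′ k′ (X ∩ P)) →
    ∀ t → WidthLe G S k t → WidthLeᴹ G S′ k′ (restrict P? t)
  WidthLe-restrict P? cut (leaf v) w with P? v
  ... | yes Pv = CutRankLe-cong (proj₁ , λ { (here refl) → here refl , Pv }) (cut w)
  ... | no  _  = tt
  WidthLe-restrict P? cut (node l r) (wl , wr , c) =
    WidthLe-join (restrict P? l) (restrict P? r)
      (WidthLe-restrict P? cut l wl) (WidthLe-restrict P? cut r wr)
      (CutRankLe-cong (∈-restrict P? (node l r)) (cut c))

  RwLe-fromTree : ∀ {k} (T : Maybe (BTree (n G))) → Unique (leavesᴹ T) →
    (∀ v → v ∈ leavesᴹ T) → WidthLeᴹ G everything k T → RwLe G everything k
  RwLe-fromTree nothing  _ covers _ = inj₁ λ v → ⊥-elim (¬Any[] (covers v))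
  RwLe-fromTree (just t) u covers w = inj₂ (t , (u , λ v → (λ _ → covers v) , λ _ → refl) , w)

  combine : ∀ {k} {P Q : Pred (Fin (n G)) 0ℓ} →
    PartialRankDecomposition G k P → PartialRankDecomposition G k Q →
    (∀ {v} → P v → Q v → ⊥) → (∀ v → P v ⊎ Q v) → RwLe G everything k
  combine D E disjoint P∪Q =
    RwLe-fromTree (join s t) unique-join covers
      (WidthLe-join s t (width D) (width E) (CutRankLe-everything covers))
    where
      open PartialRankDecomposition
      s t : Maybe (BTree (n G))
      s = tree D
      t = tree E

      unique-join : Unique (leavesᴹ (join s t))
      unique-join = subst Unique (sym (leaves-join s t))
        (Unique.++⁺ (unique D) (unique E)
          λ (v∈s , v∈t) → disjoint (proj₁ (leaves≐ D) v∈s) (proj₁ (leaves≐ E) v∈t))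

      covers : ∀ v → v ∈ leavesᴹ (join s t)
      covers v = subst (v ∈_) (sym (leaves-join s t))
        ([ (λ v∈P → ∈-++⁺ˡ (proj₂ (leaves≐ D) v∈P)) ,
           (λ v∈Q → ∈-++⁺ʳ (leavesᴹ s) (proj₂ (leaves≐ E) v∈Q)) ]′ (P∪Q v))

  hasNeighbourIn : {P : Pred V 0ℓ} → Decidable P → V → Bool
  hasNeighbourIn P? u = does (any? λ z → (adj G u z ≟ᵇ true) ×-dec P? z)

  hasNeighbourIn-intro : ∀ {P : Pred V 0ℓ} (P? : Decidable P) {u z} →
    adj G u z ≡ true → P z → hasNeighbourIn P? u ≡ true
  hasNeighbourIn-intro P? {z = z} uz Pz = dec-true (any? _) (z , uz , Pz)

  hasNeighbourIn-elim : ∀ {P : Pred V 0ℓ} (P? : Decidable P) {u} →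
    hasNeighbourIn P? u ≡ true → ∃ λ z → adj G u z ≡ true × P z
  hasNeighbourIn-elim P? {u} h with any? (λ z → (adj G u z ≟ᵇ true) ×-dec P? z) | h
  ... | yes nb | _ = nb
  ... | no  _  | ()

  IsSplit⇒RankOneCut : ∀ {C A} → (∀ v → C v ≡ true) → IsSplit G C A → RankOneCut G A
  IsSplit⇒RankOneCut {C} {A} C≡V (_ , _ , same-nbhd) = record
    { row = hasNeighbourIn Out? ; col = hasNeighbourIn In? ; factor = factor }
    where
      In? : Decidable (λ v → A v ≡ true)
      In? v = A v ≟ᵇ true

      Out? : Decidable (λ v → A v ≡ false)
      Out? v = A v ≟ᵇ false

      inN[B] : ∀ {u z} → A u ≡ true → adj G u z ≡ true → A z ≡ false →
        NbIn G C (λ v → (C v ≡ true) × (A v ≡ false)) u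
      inN[B] {z = z} u∈A uz z∉A =
        C≡V _ , (λ (_ , u∉A) → not-¬ u∈A u∉A) , z , (C≡V z , z∉A) , uz

      inN[A] : ∀ {u z} → A u ≡ false → adj G u z ≡ true → A z ≡ true →
        NbIn G C (λ v → (C v ≡ true) × (A v ≡ true)) u
      inN[A] {z = z} u∉A uz z∈A =
        C≡V _ , (λ (_ , u∈A) → not-¬ u∈A u∉A) , z , (C≡V z , z∈A) , uz

      factor : ∀ {a b} → A a ≡ true → A b ≡ false →
        adj G a b ≡ hasNeighbourIn Out? a ∧ hasNeighbourIn In? b
      factor {a} {b} a∈A b∉A with adj G a b in ab
      ... | true = sym (cong₂ _∧_ (hasNeighbourIn-intro Out? ab b∉A)
                                  (hasNeighbourIn-intro In? (trans (Graph.sym G b a) ab) a∈A))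
      ... | false with hasNeighbourIn Out? a in ha | hasNeighbourIn In? b in hb
      ...   | false | _     = refl
      ...   | true  | false = refl
      ...   | true  | true  = ⊥-elim (not-¬ adjacent ab)
        where
          -- a and a neighbour z′ ∈ A of b both lie in N(B), so a sees b as z′ does
          adjacent : adj G a b ≡ true
          adjacent with hasNeighbourIn-elim Out? ha | hasNeighbourIn-elim In? hb
          ... | z , az , z∉A | z′ , bz′ , z′∈A =
            let z′b = trans (Graph.sym G z′ b) bz′ in
            trans (same-nbhd a z′ b (inN[B] a∈A az z∉A) (inN[B] z′∈A z′b b∉A)
                                    (inN[A] b∉A bz′ z′∈A))
                  z′b

  SplitModule⇒RankOneCut : ∀ {M} → Connected G → SplitModule G M → RankOneCut G M
  SplitModule⇒RankOneCut _ (inj₁ M≡V) = record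
    { row = everything ; col = everything ; factor = λ _ b∉M → ⊥-elim (not-¬ (M≡V _) b∉M) }
  SplitModule⇒RankOneCut _ (inj₂ (inj₁ M≡∅)) = record
    { row = everything ; col = everything ; factor = λ a∈M _ → ⊥-elim (not-¬ a∈M (M≡∅ _)) }
  SplitModule⇒RankOneCut connected (inj₂ (inj₂ (C , (c , C≐reach) , _ , split))) =
    IsSplit⇒RankOneCut (λ v → proj₂ (C≐reach v) (connected c v)) split

module Glue {G : Graph} (A M : Sub (n G)) (cut : RankOneCut G A)
            (cover : ∀ v → (A v ∨ M v) ≡ true) where

  open RankOneCut cut

  private
    V : Set
    V = Fin (n G)

  In Out : Pred V 0ℓ
  In  v = A v ≡ true
  Out v = A v ≡ false

  Out⊆M : ∀ {v} → Out v → M v ≡ true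
  Out⊆M {v} v∉A = trans (cong (_∨ M v) (sym v∉A)) (cover v)

  In-or-Out : ∀ v → In v ⊎ Out v
  In-or-Out v with A v
  ... | true  = inj₁ refl
  ... | false = inj₂ refl

  cut-inside : ∀ {k X} → X ⊆ In → CutRankLe G A k X → CutRankLe G everything (suc k) X
  cut-inside X⊆A rank =
    RankLe-extend {G = G} (λ y → A y ≟ᵇ false) row col (λ x∈X _ y∉A → factor (X⊆A x∈X) y∉A)
      (RankLe-⊆ {G = G} (λ x∈X → x∈X) (λ ((_ , y∉X) , ¬y∉A) → ¬-not ¬y∉A , y∉X) rank)

  cut-outside : ∀ {k X} → CutRankLe G M k X → CutRankLe G everything (suc k) (X ∩ Out)
  cut-outside rank =
    RankLe-extend {G = G} (λ y → A y ≟ᵇ true) col row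
      (λ {x} {y} (_ , x∉A) _ y∈A →
        trans (Graph.sym G x y) (trans (factor y∈A x∉A) (∧-comm (row y) (col x))))
      (RankLe-⊆ {G = G} proj₁ (λ ((_ , y∉X∩Out) , ¬y∈A) →
        Out⊆M (¬-not ¬y∈A) , λ y∈X → y∉X∩Out (y∈X , ¬-not ¬y∈A)) rank)

  inside : ∀ {k} → RwLe G A k → PartialRankDecomposition G (suc k) In
  inside (inj₁ A≡∅) = record
    { tree = nothing ; unique = []
    ; leaves≐ = (λ ()) , λ {v} v∈A → ⊥-elim (not-¬ v∈A (A≡∅ v)) ; width = tt }
  inside (inj₂ (t , (u , t≐A) , w)) = record
    { tree = just t ; unique = u
    ; leaves≐ = (λ {v} → proj₂ (t≐A v)) , (λ {v} → proj₁ (t≐A v))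
    ; width = WidthLe-map t (λ X⊆t → cut-inside (λ {v} v∈X → proj₂ (t≐A v) (X⊆t v∈X))) w }

  outside : ∀ {k} → RwLe G M k → PartialRankDecomposition G (suc k) Out
  outside (inj₁ M≡∅) = record
    { tree = nothing ; unique = []
    ; leaves≐ = (λ ()) , λ {v} v∉A → ⊥-elim (not-¬ (Out⊆M v∉A) (M≡∅ v)) ; width = tt }
  outside (inj₂ (t , (u , t≐M) , w)) = record
    { tree = restrict Out? t
    ; unique = subst Unique (sym (leaves-restrict Out? t)) (Unique.filter⁺ Out? u)
    ; leaves≐ = (λ v∈t′ → proj₂ (proj₂ (∈-restrict Out? t) v∈t′)) ,
                (λ {v} v∉A → proj₁ (∈-restrict Out? t) (proj₁ (t≐M v) (Out⊆M v∉A) , v∉A))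
    ; width = WidthLe-restrict Out? cut-outside t w }
    where
      Out? : Decidable Out
      Out? v = A v ≟ᵇ false

  rw-glue : ∀ {k} → RwLe G A k → RwLe G M k → RwLe G everything (suc k)
  rw-glue rwA rwM = combine (inside rwA) (outside rwM) not-¬ In-or-Out

lemma5 : (k : ℕ) (G : Graph) → Connected G →
    (M₁ M₂ : Sub (n G)) → SplitModule G M₁ → SplitModule G M₂ →
    (∀ v → (M₁ v ∨ M₂ v) ≡ true) →
    RwLe G M₁ k → RwLe G M₂ k →
    RwLe G (λ _ → true) (suc k)
lemma5 k G connected M₁ M₂ split₁ _ cover =
  Glue.rw-glue M₁ M₂ (SplitModule⇒RankOneCut connected split₁) cover
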